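{- Let $\mathrm{OPT}_{\mathrm{GF+DS}}$ be the value of an optimal $k$-center clustering satisfying both group fairness and diverse center selection. Let $\lambda^{\mathrm{LP}}$ be the minimal value such that $\mathrm{LP}(\lambda^{\mathrm{LP}})$ has a solution, and let $\lambda^{\mathrm{DS}}$ be the minimal value such that $\mathrm{cost}_{\mathrm{DS}}\le\alpha\cdot\lambda^{\mathrm{DS}}$, where $\mathrm{cost}_{\mathrm{DS}}$ is the $k$-center cost of the solution returned by a given $\alpha$-approximation algorithm for $k$-center with diverse center selection. Then $\lambda:=\max\{\lambda^{\mathrm{LP}},\lambda^{\mathrm{DS}}\}\le\mathrm{OPT}_{\mathrm{GF+DS}}$.
   Context: Let $(P,d)$ be a finite metric space, $k\in\{1,\dots,|P|\}$, $P=P_1\,\dot\cup\dots\dot\cup\,P_m$ a partition into color classes, $H=\{1,\dots,m\}$. A $k$-center clustering is $(\mathcal{C},\varphi)$ with $\mathcal{C}\subseteq P$, $|\mathcal{C}|\le k$, $\varphi:P\to\mathcal{C}$, of cost $\max_pd(p,\varphi(p))$. Group fairness: given $0\le\ell_h\le u_h\le1$, every cluster $C=\varphi^{ -1}(c)$ satisfies $\ell_h|C|\le|C\cap P_h|\le u_h|C|$ for all $h$. Diverse center selection: given integers $L_h\le U_h$ with $\sum_hL_h\le k\le\sum_hU_h$, $L_h\le|\mathcal{C}\cap P_h|\le U_h$ for all $h$. The instance is assumed to have a clustering satisfying both. An $\alpha$-approximation algorithm for $k$-center with diverse center selection returns a clustering satisfying diverse center selection with cost at most $\alpha$ times the optimum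 over such clusterings. For $\lambda\ge0$, $\mathrm{LP}(\lambda)$ is the system in variables $x_{ij},y_i$ ($i,j\in P$): $\sum_ix_{ij}=1$ for all $j$; $x_{ij}\le y_i$; $\sum_iy_i\le k$; $\ell_h\sum_{j\in P}x_{ij}\le\sum_{j\in P_h}x_{ij}\le u_h\sum_{j\in P}x_{ij}$ for all $h,i$; $x_{ij}=0$ whenever $d(i,j)>\lambda$; $0\le x_{ij},y_i\le1$.
   Formalization: The metric $d$ takes rational values, and the fairness bounds $\ell_h$ and $u_h$, the factor $\alpha$ and the variables $x_{ij},y_i$ of LP(λ) are rational. -}

module Defs where

open import Data.Nat as ℕ using (ℕ; zero; suc)
open import Data.Integer using (+_)
open import Data.Rational using (ℚ; 0ℚ; 1ℚ; _+_; _*_; _≤_; _<_; _⊔_; _/_)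
open import Data.Fin using (Fin; zero; suc)
open import Data.Fin.Properties using () renaming (_≟_ to _≟ᶠ_)
open import Data.Bool using (Bool; true; false; _∧_; if_then_else_)
open import Data.Product using (_×_; Σ; _,_)
open import Relation.Nullary.Decidable using (⌊_⌋)
open import Relation.Binary.PropositionalEquality using (_≡_)

ℕ→ℚ : ℕ → ℚ
ℕ→ℚ k = (+ k) / 1

card : ∀ {n} → (Fin n → Bool) → ℕ
card {zero} f = zero
card {suc n} f = (if f zero then 1 else 0) ℕ.+ card (λ i → f (suc i))

sumQ : ∀ {n} → (Fin n → ℚ) → ℚ
sumQ {zero} f = 0ℚ
sumQ {suc n} f = f zero + sumQ (λ i → f (suc i))

-- maximum of rational values over Fin n (0 for the empty index set;
-- used only for nonnegative distances)
maxQ : ∀ {n} → (Fin n → ℚ) → ℚ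
maxQ {zero} f = 0ℚ
maxQ {suc n} f = f zero ⊔ maxQ (λ i → f (suc i))

IsLeast : (ℚ → Set) → ℚ → Set
IsLeast S x = S x × (∀ y → S y → x ≤ y)

record IsMetric {n : ℕ} (d : Fin n → Fin n → ℚ) : Set where
  field
    nonneg  : ∀ p q → 0ℚ ≤ d p q
    refl0   : ∀ p → d p p ≡ 0ℚ
    ident   : ∀ p q → d p q ≡ 0ℚ → p ≡ q
    symm    : ∀ p q → d p q ≡ d q p
    triangle : ∀ p q r → d p r ≤ d p q + d q r

record Clustering (n k : ℕ) : Set where
  field
    centers : Fin n → Bool
    assign  : Fin n → Fin n
    assign-center : ∀ p → centers (assign p) ≡ true
    atMostK : card centers ℕ.≤ k

open Clustering public

cost : ∀ {n k} → (Fin n → Fin n → ℚ) → Clustering n k → ℚ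
cost d K = maxQ (λ p → d p (assign K p))

clusterSize : ∀ {n k} → Clustering n k → Fin n → ℕ
clusterSize K c = card (λ p → ⌊ assign K p ≟ᶠ c ⌋)

clusterColSize : ∀ {n m k} → (Fin n → Fin m) → Clustering n k → Fin n → Fin m → ℕ
clusterColSize col K c h = card (λ p → ⌊ assign K p ≟ᶠ c ⌋ ∧ ⌊ col p ≟ᶠ h ⌋)

GroupFair : ∀ {n m k} → (Fin n → Fin m) → (ℓ u : Fin m → ℚ) → Clustering n k → Set
GroupFair col ℓ u K =
  ∀ c h → (ℓ h * ℕ→ℚ (clusterSize K c) ≤ ℕ→ℚ (clusterColSize col K c h))
        × (ℕ→ℚ (clusterColSize col K c h) ≤ u h * ℕ→ℚ (clusterSize K c))

DiverseCenters : ∀ {n m k} → (Fin n → Fin m) → (L U : Fin m → ℕ) → Clustering n k → Set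
DiverseCenters col L U K =
  ∀ h → (L h ℕ.≤ card (λ c → centers K c ∧ ⌊ col c ≟ᶠ h ⌋))
      × (card (λ c → centers K c ∧ ⌊ col c ≟ᶠ h ⌋) ℕ.≤ U h)

LPFeasible : ∀ {n m} → (d : Fin n → Fin n → ℚ) → (k : ℕ) → (col : Fin n → Fin m)
           → (ℓ u : Fin m → ℚ) → ℚ → Set
LPFeasible {n} {m} d k col ℓ u lam =
  Σ (Fin n → Fin n → ℚ) λ x → Σ (Fin n → ℚ) λ y →
      (∀ j → sumQ (λ i → x i j) ≡ 1ℚ)
    × (∀ i j → x i j ≤ y i)
    × (sumQ y ≤ ℕ→ℚ k)
    × (∀ h i → (ℓ h * sumQ (λ j → x i j)
                 ≤ sumQ (λ j → if ⌊ col j ≟ᶠ h ⌋ then x i j else 0ℚ))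
             × (sumQ (λ j → if ⌊ col j ≟ᶠ h ⌋ then x i j else 0ℚ)
                 ≤ u h * sumQ (λ j → x i j)))
    × (∀ i j → lam < d i j → x i j ≡ 0ℚ)
    × (∀ i j → (0ℚ ≤ x i j) × (x i j ≤ 1ℚ))
    × (∀ i → (0ℚ ≤ y i) × (y i ≤ 1ℚ))

sumN : ∀ {m} → (Fin m → ℕ) → ℕ
sumN {zero} f = zero
sumN {suc m} f = f zero ℕ.+ sumN (λ i → f (suc i))

{-# OPTIONS --safe #-}
-- The optimal clustering for group fairness plus diverse center selection, read as the 0/1
-- point x_ij = [φ(j) = i], y_i = [i ∈ C], is feasible for LP(OPT_GF+DS), so λ^LP ≤ OPT_GF+DS.
-- It also selects diverse centers, so OPT_DS ≤ OPT_GF+DS and cost_DS ≤ α·OPT_DS ≤ α·OPT_GF+DS,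
-- which gives λ^DS ≤ OPT_GF+DS.
module Submission where

open import Defs
open import Data.Nat as ℕ using (ℕ; zero; suc)
import Data.Nat.Coprimality as Coprimality
open import Data.Integer as ℤ using (+_)
import Data.Integer.Properties as ℤ
open import Data.Rational using (ℚ; mkℚ; 0ℚ; 1ℚ; _+_; _*_; _≤_; _<_; _⊔_; toℚᵘ; *≤*; nonNegative)
open import Data.Rational.Properties
open import Data.Rational.Unnormalised as ℚᵘ using (mkℚᵘ; 1ℚᵘ; *≡*)
import Data.Rational.Unnormalised.Properties as ℚᵘ
open import Data.Fin using (Fin; zero; suc)
open import Data.Fin.Properties using () renaming (_≟_ to _≟ᶠ_)
open import Data.Bool using (Bool; true; false; _∧_; if_then_else_)
open import Data.Product using (_×_; Σ; _,_)
open import Data.Empty using (⊥-elim)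
open import Relation.Nullary using (yes; no)
open import Relation.Nullary.Decidable using (⌊_⌋)
open import Relation.Binary.PropositionalEquality

ℕ→ℚ≡mkℚ : ∀ n → ℕ→ℚ n ≡ mkℚ (+ n) 0 (Coprimality.sym (Coprimality.1-coprimeTo n))
ℕ→ℚ≡mkℚ n = normalize-coprime (Coprimality.sym (Coprimality.1-coprimeTo n))

ℕ→ℚ-suc : ∀ n → ℕ→ℚ (suc n) ≡ 1ℚ + ℕ→ℚ n
ℕ→ℚ-suc n = toℚᵘ-injective (begin
  toℚᵘ (ℕ→ℚ (suc n))            ≡⟨ cong toℚᵘ (ℕ→ℚ≡mkℚ (suc n)) ⟩
  mkℚᵘ (+ suc n) 0              ≈⟨ *≡* numerators ⟩
  1ℚᵘ ℚᵘ.+ mkℚᵘ (+ n) 0          ≡⟨ cong (λ q → 1ℚᵘ ℚᵘ.+ toℚᵘ q) (ℕ→ℚ≡mkℚ n) ⟨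
  toℚᵘ 1ℚ ℚᵘ.+ toℚᵘ (ℕ→ℚ n)      ≈⟨ toℚᵘ-homo-+ 1ℚ (ℕ→ℚ n) ⟨
  toℚᵘ (1ℚ + ℕ→ℚ n)             ∎)
  where
  open ℚᵘ.≃-Reasoning
  numerators : + suc n ℤ.* + 1 ≡ (+ 1 ℤ.+ + n ℤ.* + 1) ℤ.* + 1
  numerators = cong (λ z → (+ 1 ℤ.+ z) ℤ.* + 1) (sym (ℤ.*-identityʳ (+ n)))

ℕ→ℚ-mono-≤ : ∀ {a b} → a ℕ.≤ b → ℕ→ℚ a ≤ ℕ→ℚ b
ℕ→ℚ-mono-≤ {a} {b} a≤b rewrite ℕ→ℚ≡mkℚ a | ℕ→ℚ≡mkℚ b =
  *≤* (ℤ.*-monoʳ-≤-nonNeg (+ 1) (ℤ.+≤+ a≤b))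

indicator : Bool → ℚ
indicator b = if b then 1ℚ else 0ℚ

0≤indicator : ∀ b → 0ℚ ≤ indicator b
0≤indicator true  = nonNegative⁻¹ 1ℚ
0≤indicator false = ≤-refl

indicator≤1 : ∀ b → indicator b ≤ 1ℚ
indicator≤1 true  = ≤-refl
indicator≤1 false = nonNegative⁻¹ 1ℚ

indicator-∧ : ∀ a c → (if c then indicator a else 0ℚ) ≡ indicator (a ∧ c)
indicator-∧ false false = refl
indicator-∧ false true  = refl
indicator-∧ true  false = refl
indicator-∧ true  true  = refl

sumQ-cong : ∀ {n} {f g : Fin n → ℚ} → (∀ i → f i ≡ g i) → sumQ f ≡ sumQ g
sumQ-cong {zero}  f≗g = refl
sumQ-cong {suc n} f≗g = cong₂ _+_ (f≗g zero) (sumQ-cong (λ i → f≗g (suc i)))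

sumQ-indicator : ∀ {n} (b : Fin n → Bool) → sumQ (λ i → indicator (b i)) ≡ ℕ→ℚ (card b)
sumQ-indicator {zero}  b = refl
sumQ-indicator {suc n} b with b zero
... | true  = trans (cong (λ q → 1ℚ + q) (sumQ-indicator (λ i → b (suc i))))
                    (sym (ℕ→ℚ-suc (card (λ i → b (suc i)))))
... | false = trans (+-identityˡ _) (sumQ-indicator (λ i → b (suc i)))

card-cong : ∀ {n} {f g : Fin n → Bool} → (∀ i → f i ≡ g i) → card f ≡ card g
card-cong {zero}  f≗g = refl
card-cong {suc n} f≗g =
  cong₂ ℕ._+_ (cong (λ b → if b then 1 else 0) (f≗g zero)) (card-cong (λ i → f≗g (suc i)))

card-false : ∀ {n} (f : Fin n → Bool) → (∀ i → f i ≡ false) → card f ≡ 0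
card-false {zero}  f f≗false = refl
card-false {suc n} f f≗false rewrite f≗false zero =
  card-false (λ i → f (suc i)) (λ i → f≗false (suc i))

card-singleton : ∀ {n} (a : Fin n) → card (λ i → ⌊ a ≟ᶠ i ⌋) ≡ 1
card-singleton {suc n} zero    = cong suc (card-false {n} (λ i → ⌊ zero ≟ᶠ suc i ⌋) (λ i → refl))
card-singleton {suc n} (suc a) = trans (card-cong suc-≟) (card-singleton a)
  where
  suc-≟ : ∀ i → ⌊ suc a ≟ᶠ suc i ⌋ ≡ ⌊ a ≟ᶠ i ⌋
  suc-≟ i with a ≟ᶠ i
  ... | yes _ = refl
  ... | no  _ = refl

maxQ-upperBound : ∀ {n} (f : Fin n → ℚ) p → f p ≤ maxQ f
maxQ-upperBound f zero    = p≤p⊔q (f zero) (maxQ (λ i → f (suc i)))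
maxQ-upperBound f (suc p) =
  ≤-trans (maxQ-upperBound (λ i → f (suc i)) p) (p≤q⊔p (f zero) (maxQ (λ i → f (suc i))))

maxQ-nonNeg : ∀ {n} (f : Fin n → ℚ) → (∀ p → 0ℚ ≤ f p) → 0ℚ ≤ maxQ f
maxQ-nonNeg {zero}  f f≥0 = ≤-refl
maxQ-nonNeg {suc n} f f≥0 = ≤-trans (f≥0 zero) (p≤p⊔q (f zero) (maxQ (λ i → f (suc i))))

module _ {n k : ℕ} (K : Clustering n k) where

  assignmentMatrix : Fin n → Fin n → ℚ
  assignmentMatrix i j = indicator ⌊ assign K j ≟ᶠ i ⌋

  centerIndicator : Fin n → ℚ
  centerIndicator i = indicator (centers K i)

  assignmentMatrix-colSum : ∀ j → sumQ (λ i → assignmentMatrix i j) ≡ 1ℚ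
  assignmentMatrix-colSum j =
    trans (sumQ-indicator (λ i → ⌊ assign K j ≟ᶠ i ⌋)) (cong ℕ→ℚ (card-singleton (assign K j)))

  assignmentMatrix-rowSum : ∀ i → sumQ (λ j → assignmentMatrix i j) ≡ ℕ→ℚ (clusterSize K i)
  assignmentMatrix-rowSum i = sumQ-indicator (λ j → ⌊ assign K j ≟ᶠ i ⌋)

  assignmentMatrix-colourRowSum : ∀ {m} (col : Fin n → Fin m) h i →
    sumQ (λ j → if ⌊ col j ≟ᶠ h ⌋ then assignmentMatrix i j else 0ℚ)
      ≡ ℕ→ℚ (clusterColSize col K i h)
  assignmentMatrix-colourRowSum col h i =
    trans (sumQ-cong (λ j → indicator-∧ ⌊ assign K j ≟ᶠ i ⌋ ⌊ col j ≟ᶠ h ⌋))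
          (sumQ-indicator (λ j → ⌊ assign K j ≟ᶠ i ⌋ ∧ ⌊ col j ≟ᶠ h ⌋))

  assignmentMatrix≤centerIndicator : ∀ i j → assignmentMatrix i j ≤ centerIndicator i
  assignmentMatrix≤centerIndicator i j with assign K j ≟ᶠ i
  ... | yes refl rewrite assign-center K j = ≤-refl
  ... | no  _    = 0≤indicator (centers K i)

  sumQ-centerIndicator≤k : sumQ centerIndicator ≤ ℕ→ℚ k
  sumQ-centerIndicator≤k =
    subst (_≤ ℕ→ℚ k) (sym (sumQ-indicator (centers K))) (ℕ→ℚ-mono-≤ (atMostK K))

  module _ (d : Fin n → Fin n → ℚ) where

    d-assign≤cost : ∀ p → d p (assign K p) ≤ cost d K
    d-assign≤cost = maxQ-upperBound (λ p → d p (assign K p))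

    cost-nonNeg : (∀ p q → 0ℚ ≤ d p q) → 0ℚ ≤ cost d K
    cost-nonNeg d≥0 = maxQ-nonNeg (λ p → d p (assign K p)) (λ p → d≥0 p (assign K p))

    assignmentMatrix-vanishes-beyond-cost : (∀ p q → d p q ≡ d q p) →
      ∀ i j → cost d K < d i j → assignmentMatrix i j ≡ 0ℚ
    assignmentMatrix-vanishes-beyond-cost d-sym i j cost<dij with assign K j ≟ᶠ i
    ... | yes refl = ⊥-elim (<-irrefl refl (<-≤-trans cost<dij d-center-j≤cost))
      where
      d-center-j≤cost : d (assign K j) j ≤ cost d K
      d-center-j≤cost = subst (_≤ cost d K) (d-sym j (assign K j)) (d-assign≤cost j)
    ... | no  _    = refl

groupFair⇒LPFeasible : ∀ {n m k} (d : Fin n → Fin n → ℚ) → (∀ p q → d p q ≡ d q p) →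
  (col : Fin n → Fin m) (ℓ u : Fin m → ℚ) (K : Clustering n k) →
  GroupFair col ℓ u K → LPFeasible d k col ℓ u (cost d K)
groupFair⇒LPFeasible d d-sym col ℓ u K fair =
    assignmentMatrix K , centerIndicator K
  , assignmentMatrix-colSum K
  , assignmentMatrix≤centerIndicator K
  , sumQ-centerIndicator≤k K
  , fairRows
  , assignmentMatrix-vanishes-beyond-cost K d d-sym
  , (λ i j → 0≤indicator _ , indicator≤1 _)
  , (λ i → 0≤indicator _ , indicator≤1 _)
  where
  fairRows : ∀ h i →
      (ℓ h * sumQ (λ j → assignmentMatrix K i j)
         ≤ sumQ (λ j → if ⌊ col j ≟ᶠ h ⌋ then assignmentMatrix K i j else 0ℚ))
    × (sumQ (λ j → if ⌊ col j ≟ᶠ h ⌋ then assignmentMatrix K i j else 0ℚ)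
         ≤ u h * sumQ (λ j → assignmentMatrix K i j))
  fairRows h i rewrite assignmentMatrix-rowSum K i | assignmentMatrix-colourRowSum K col h i =
    fair i h

lemma9 : (n m k : ℕ) (d : Fin n → Fin n → ℚ) → IsMetric d
    → 1 ℕ.≤ k → k ℕ.≤ n
    → (col : Fin n → Fin m)
    → (ℓ u : Fin m → ℚ) → (∀ h → (0ℚ ≤ ℓ h) × (ℓ h ≤ u h) × (u h ≤ 1ℚ))
    → (L U : Fin m → ℕ) → (∀ h → L h ℕ.≤ U h) → sumN L ℕ.≤ k → k ℕ.≤ sumN U
    -- OPT_GF+DS : optimal cost over clusterings with group fairness and diverse centers
    → (optGFDS : ℚ)
    → IsLeast (λ c → Σ (Clustering n k) λ K →
                 GroupFair col ℓ u K × DiverseCenters col L U K × cost d K ≡ c) optGFDS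
    -- a given α-approximation for k-center with diverse center selection:
    -- its output KDS satisfies diverse center selection and
    -- cost ≤ α · OPT_DS
    → (α : ℚ) → 1ℚ ≤ α
    → (optDS : ℚ)
    → IsLeast (λ c → Σ (Clustering n k) λ K →
                 DiverseCenters col L U K × cost d K ≡ c) optDS
    → (KDS : Clustering n k) → DiverseCenters col L U KDS
    → cost d KDS ≤ α * optDS
    -- λ^LP and λ^DS
    → (λLP : ℚ) → IsLeast (λ t → (0ℚ ≤ t) × LPFeasible d k col ℓ u t) λLP
    → (λDS : ℚ) → IsLeast (λ t → (0ℚ ≤ t) × (cost d KDS ≤ α * t)) λDS
    → (λLP ⊔ λDS) ≤ optGFDS
lemma9 n m k d metric _ _ col ℓ u _ L U _ _ _ _ ((K , fair , diverse , refl) , _) α 1≤α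
       optDS (_ , optDS-least) KDS _ costDS≤α·optDS _ (_ , λLP-least) _ (_ , λDS-least) =
  ⊔-lub (λLP-least (cost d K) (0≤OPT , LP-feasible-at-OPT))
        (λDS-least (cost d K) (0≤OPT , costDS≤α·OPT))
  where
  LP-feasible-at-OPT : LPFeasible d k col ℓ u (cost d K)
  LP-feasible-at-OPT = groupFair⇒LPFeasible d (IsMetric.symm metric) col ℓ u K fair

  0≤OPT : 0ℚ ≤ cost d K
  0≤OPT = cost-nonNeg K d (IsMetric.nonneg metric)

  costDS≤α·OPT : cost d KDS ≤ α * cost d K
  costDS≤α·OPT = ≤-trans costDS≤α·optDS
    (*-monoˡ-≤-nonNeg α {{nonNegative (≤-trans (nonNegative⁻¹ 1ℚ) 1≤α)}} optDS≤OPT)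
    where
    optDS≤OPT : optDS ≤ cost d K
    optDS≤OPT = optDS-least (cost d K) (K , diverse , refl)
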